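{- Let $\mathcal F=\mathcal C\cup\mathcal D$ be a signature with a precedence $>$ and rank $\mathrm{rk}$ as in the context, let $\ell\ge 1$, and let $d$ be such that $\mathrm{ar}(f)\le d$ for all $f\in\mathcal F$. Then for every $f\in\mathcal F$ of arity $k\le \ell$ and all closed constructor terms $s_1,\dots,s_k\in\mathcal T(\mathcal C)$, $$G_\ell(f(s_1,\dots,s_k)) \le d^{\mathrm{rk}(f)}\cdot(1+\ell)^{\mathrm{rk}(f)}\cdot\Bigl(1+\sum_{j=1}^k \mathrm{depth}(s_j)\Bigr),$$ where $\mathrm{depth}(t)$ is the depth of $t$ in its standard tree representation.
   Context: $\mathcal F$ is partitioned into constructors $\mathcal C$ and defined symbols $\mathcal D$; $\mathcal T(\mathcal C)$ denotes closed terms built from constructors. A precedence is a well-founded strict partial order $>$ on $\mathcal F$, with every constructor $>$-minimal; $\mathrm{rk}:\mathcal F\to\mathbb N$ is a rank satisfying $\mathrm{rk}(f)>\mathrm{rk}(g)\iff f>g$. $s\rhd t$ means $t$ is a proper subterm of $s$. A sequence is $[t_1\cdots t_k]$ ($k\ge0$) of terms; $\mathbin{+\!\!+}$ is concatenation (a term $t$ read as $[t]$). For $\ell\ge 1$, $a>_\ell b$ holds iff one of: (i) $a=f(s_1,\dots,s_k)$, $b=g(t_1,\dots,t_l)$, $f,g\in\mathcal F$, $f>g$, $a\rhd t_j$ for all $j\le l$, $l\le\ell$; (ii) $a=f(s_1,\dots,s_k)$, $b=[t_1\cdots t_l]$, $a>_\ell t_j$ for all $j\le l$, $l\le\ell$;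 (iii) $a=[s_1\cdots s_k]$, $b=[t_1\cdots t_l]$, and for some permutation $\pi$ of $\{1,\dots,l\}$ and terms or sequences $b_1,\dots,b_k$ with $b_1\mathbin{+\!\!+}\cdots\mathbin{+\!\!+}b_k=[t_{\pi(1)}\cdots t_{\pi(l)}]$ one has $s_j\ge_\ell b_j$ for all $j$ and $s_i>_\ell b_i$ for some $i$ ($\ge_\ell$: $>_\ell$ or equal). The relation $>_\ell$ is well-founded, and $G_\ell(a)$ is the maximal $k$ such that there exist $a_1,\dots,a_k$ with $a>_\ell a_1>_\ell\cdots>_\ell a_k$. -}

module Defs where

open import Data.Nat using (ℕ; zero; suc; _+_; _*_; _^_; _≤_; _<_; _>_; _⊔_)
open import Data.Fin using (Fin)
open import Data.Vec using (Vec; []; _∷_; lookup)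
open import Data.List using (List; []; _∷_; length; concat; map)
open import Data.List.Relation.Unary.All using (All)
open import Data.List.Relation.Unary.Any using (Any)
open import Data.List.Relation.Binary.Pointwise using (Pointwise)
open import Data.List.Relation.Binary.Permutation.Propositional using (_↭_)
open import Data.Product using (Σ; _×_)
open import Data.Sum using (_⊎_)
open import Relation.Binary.PropositionalEquality using (_≡_)

-- A signature F: function symbols with arities; `Con f` singles out the
-- constructors C (the defined symbols D are the remaining symbols).
record Signature : Set₁ where
  field
    Sym : Set
    ar  : Sym → ℕ
    Con : Sym → Set

module _ (S : Signature) where
  open Signature S

  data Term : Set where
    app : (f : Sym) → Vec Term (ar f) → Term

  data Sub : Term → Term → Set where
    arg    : ∀ {f ts} (i : Fin (ar f)) → Sub (app f ts) (lookup ts i)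
    deeper : ∀ {f ts u} (i : Fin (ar f)) → Sub (lookup ts i) u → Sub (app f ts) u

  data IsConTerm : Term → Set where
    con : ∀ {f ts} → Con f → (∀ i → IsConTerm (lookup ts i)) → IsConTerm (app f ts)

  -- depth (height) of the term tree; a constant has depth 0
  mutual
    depth : Term → ℕ
    depth (app f ts) = depthVec ts

    depthVec : ∀ {n} → Vec Term n → ℕ
    depthVec []       = 0
    depthVec (t ∷ ts) = suc (depth t) ⊔ depthVec ts

  sumDepth : ∀ {n} → Vec Term n → ℕ
  sumDepth []       = 0
  sumDepth (t ∷ ts) = depth t + sumDepth ts

  data Obj : Set where
    tm : Term → Obj
    sq : List Term → Obj

  toSeq : Obj → List Term
  toSeq (tm t)  = t ∷ []
  toSeq (sq ts) = ts

  module _ (_≻_ : Sym → Sym → Set) (ℓ : ℕ) where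
    mutual
      data Gt : Obj → Obj → Set where
        gt-fun : ∀ {f ss g ts} → f ≻ g →
                 (∀ (j : Fin (ar g)) → Sub (app f ss) (lookup ts j)) →
                 ar g ≤ ℓ →
                 Gt (tm (app f ss)) (tm (app g ts))
        gt-seq : ∀ {a ts} → All (λ t → Gt (tm a) (tm t)) ts → length ts ≤ ℓ →
                 Gt (tm a) (sq ts)
        gt-mul : ∀ {ss ts} (bs : List Obj) →
                 concat (map toSeq bs) ↭ ts →
                 Pointwise (λ s b → Ge (tm s) b) ss bs →
                 Any (λ p → Gt (tm (Data.Product.proj₁ p)) (Data.Product.proj₂ p))
                     (Data.List.zip ss bs) →
                 Gt (sq ss) (sq ts)

      data Ge : Obj → Obj → Set where
        ge-gt : ∀ {a b} → Gt a b → Ge a b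
        ge-eq : ∀ {a} → Ge a a

    data Chain : Obj → ℕ → Set where
      done : ∀ {a} → Chain a 0
      step : ∀ {a b k} → Gt a b → Chain b k → Chain a (suc k)

module Submission where

-- Proof idea: an order-preserving interpretation into ℕ.
--
-- Interpret a term  g(t₁,…,t_m)  as  φ = (d(1+ℓ))^rk(g) · (1 + Σⱼ depth tⱼ)  and a
-- sequence as the sum of the interpretations of its members (Φ).  Then every step
-- a >_ℓ b strictly decreases Φ, so a chain of length n starting in a has n ≤ Φ a,
-- and Φ (f(s₁,…,s_k)) is exactly the claimed bound.
--
-- The heart of the argument is  rank-step : if f > g and all arguments of
-- g(t₁,…,t_m) are proper subterms of f(s₁,…,s_k), then (1+ℓ)·φ(g(…)) ≤ φ(f(…)).
-- Indeed each tⱼ is shallower than Σ depth sᵢ, there are at most d of them, and the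
-- rank drops by at least one, which pays for the factor d(1+ℓ).  Rule (i) replaces
-- one such term, rule (ii) at most ℓ of them, so the sum stays below φ(f(…))
-- (sum-of-small-parts); rule (iii) is a multiset extension, handled by the general
-- pointwise-sum comparison sum-pointwise-<.

open import Defs
open import Data.Nat using (ℕ; suc; _+_; _*_; _^_; _≤_; _<_; _>_; z≤n; s≤s; NonZero; >-nonZero)
open import Data.Nat.Properties
open import Data.Nat.ListAction using (sum)
open import Data.Nat.ListAction.Properties using (sum-↭; sum-++)
open import Data.Nat.Solver using (module +-*-Solver)
open import Data.Fin using (zero; suc)
open import Data.Vec using (Vec; lookup; []; _∷_)
open import Data.List using (List; []; _∷_; _++_; map; concat; length; zip)
open import Data.List.Properties using (map-++)
open import Data.List.Relation.Unary.All using (All; []; _∷_) renaming (map to All-map)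
open import Data.List.Relation.Unary.Any using (Any; here; there)
open import Data.List.Relation.Binary.Pointwise using (Pointwise; []; _∷_)
open import Data.List.Relation.Binary.Permutation.Propositional.Properties using (map⁺)
open import Data.Product using (_×_; proj₁; proj₂)
open import Relation.Nullary using (¬_)
open import Relation.Binary.PropositionalEquality using (_≡_; refl; sym; cong; module ≡-Reasoning)
open import Relation.Binary.Structures using (IsStrictPartialOrder)
open import Induction.WellFounded using (WellFounded)

module _ {A B : Set} where

  sum-concat-map : (f : A → ℕ) (h : B → List A) (bs : List B) →
                   sum (map f (concat (map h bs))) ≡ sum (map (λ b → sum (map f (h b))) bs)
  sum-concat-map f h [] = refl
  sum-concat-map f h (b ∷ bs) = begin
    sum (map f (h b ++ concat (map h bs)))
      ≡⟨ cong sum (map-++ f (h b) (concat (map h bs))) ⟩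
    sum (map f (h b) ++ map f (concat (map h bs)))
      ≡⟨ sum-++ (map f (h b)) (map f (concat (map h bs))) ⟩
    sum (map f (h b)) + sum (map f (concat (map h bs)))
      ≡⟨ cong (sum (map f (h b)) +_) (sum-concat-map f h bs) ⟩
    sum (map f (h b)) + sum (map (λ b → sum (map f (h b))) bs) ∎
    where open ≡-Reasoning

  module _ {W T : A → B → Set} (f : A → ℕ) (g : B → ℕ)
           (weak : ∀ {a b} → W a b → g b ≤ f a) (strict : ∀ {a b} → T a b → g b < f a) where

    sum-pointwise-≤ : ∀ {as bs} → Pointwise W as bs → sum (map g bs) ≤ sum (map f as)
    sum-pointwise-≤ [] = z≤n
    sum-pointwise-≤ (w ∷ ws) = +-mono-≤ (weak w) (sum-pointwise-≤ ws)

    sum-pointwise-< : ∀ {as bs} → Pointwise W as bs →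
                      Any (λ p → T (proj₁ p) (proj₂ p)) (zip as bs) →
                      sum (map g bs) < sum (map f as)
    sum-pointwise-< (w ∷ ws) (here t)  = +-mono-<-≤ (strict t) (sum-pointwise-≤ ws)
    sum-pointwise-< (w ∷ ws) (there s) = +-mono-≤-< (weak w) (sum-pointwise-< ws s)

module _ {A : Set} (ℓ m : ℕ) (g : A → ℕ) where

  scaled-sum-≤ : ∀ {xs} → All (λ x → suc ℓ * g x ≤ m) xs → suc ℓ * sum (map g xs) ≤ length xs * m
  scaled-sum-≤ [] = ≤-reflexive (*-zeroʳ ℓ)
  scaled-sum-≤ {x ∷ xs} (p ∷ ps) = begin
    suc ℓ * (g x + sum (map g xs))          ≡⟨ *-distribˡ-+ (suc ℓ) (g x) _ ⟩
    suc ℓ * g x + suc ℓ * sum (map g xs)    ≤⟨ +-mono-≤ p (scaled-sum-≤ ps) ⟩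
    m + length xs * m                        ∎
    where open ≤-Reasoning

  sum-of-small-parts : ∀ {xs} → 1 ≤ m → length xs ≤ ℓ →
                       All (λ x → suc ℓ * g x ≤ m) xs → sum (map g xs) < m
  sum-of-small-parts {xs} m≥1 len ps = *-cancelˡ-< (suc ℓ) (sum (map g xs)) m (begin-strict
    suc ℓ * sum (map g xs)  ≤⟨ scaled-sum-≤ ps ⟩
    length xs * m           ≤⟨ *-monoˡ-≤ m len ⟩
    ℓ * m                   <⟨ m<n+m (ℓ * m) m≥1 ⟩
    suc ℓ * m               ∎)
    where open ≤-Reasoning

module Depth (S : Signature) where

  depth-lookup : ∀ {n} (ts : Vec (Term S) n) i → depth S (lookup ts i) < depthVec S ts
  depth-lookup (t ∷ ts) zero    = m≤m⊔n (suc (depth S t)) (depthVec S ts)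
  depth-lookup (t ∷ ts) (suc i) = <-≤-trans (depth-lookup ts i) (m≤n⊔m (suc (depth S t)) (depthVec S ts))

  sub-depth-< : ∀ {a u} → Sub S a u → depth S u < depth S a
  sub-depth-< (arg {ts = ts} i)      = depth-lookup ts i
  sub-depth-< (deeper {ts = ts} i p) = <-trans (sub-depth-< p) (depth-lookup ts i)

  lookup-≤-sumDepth : ∀ {n} (ts : Vec (Term S) n) i → depth S (lookup ts i) ≤ sumDepth S ts
  lookup-≤-sumDepth (t ∷ ts) zero    = m≤m+n _ _
  lookup-≤-sumDepth (t ∷ ts) (suc i) = ≤-trans (lookup-≤-sumDepth ts i) (m≤n+m _ _)

  sub-depth-≤-sumDepth : ∀ {f ss u} → Sub S (app f ss) u → depth S u ≤ sumDepth S ss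
  sub-depth-≤-sumDepth (arg {ts = ts} i)      = lookup-≤-sumDepth ts i
  sub-depth-≤-sumDepth (deeper {ts = ts} i p) = ≤-trans (<⇒≤ (sub-depth-< p)) (lookup-≤-sumDepth ts i)

  sumDepth-≤ : ∀ {n} (ts : Vec (Term S) n) D → (∀ i → depth S (lookup ts i) ≤ D) → sumDepth S ts ≤ n * D
  sumDepth-≤ []       D h = z≤n
  sumDepth-≤ (t ∷ ts) D h = +-mono-≤ (h zero) (sumDepth-≤ ts D (λ i → h (suc i)))

module Interpretation (S : Signature) (_≻_ : Signature.Sym S → Signature.Sym S → Set)
  (rk : Signature.Sym S → ℕ) (rk-mono : ∀ {f g} → f ≻ g → rk g < rk f)
  (ℓ : ℕ) (ℓ≥1 : 1 ≤ ℓ) (d : ℕ) (d≥1 : 1 ≤ d) (ar≤d : ∀ f → Signature.ar S f ≤ d) where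
  open Signature S
  open Depth S

  private instance
    d-nonZero : NonZero d
    d-nonZero = >-nonZero d≥1

  -- The weight of rank r: (d(1+ℓ))^r, written as in the statement.
  weight : ℕ → ℕ
  weight r = d ^ r * suc ℓ ^ r

  weight-mono : ∀ {r s} → r ≤ s → weight r ≤ weight s
  weight-mono r≤s = *-mono-≤ (^-monoʳ-≤ d r≤s) (^-monoʳ-≤ (suc ℓ) r≤s)

  weight-suc : ∀ r x → suc ℓ * (weight r * (d * x)) ≡ weight (suc r) * x
  weight-suc r x = solve 5 (λ a b d x l → (con 1 :+ l) :* (a :* b :* (d :* x))
                                         := d :* a :* ((con 1 :+ l) :* b) :* x)
                           refl (d ^ r) (suc ℓ ^ r) d x ℓ
    where open +-*-Solver

  φ : Term S → ℕ
  φ (app f ss) = weight (rk f) * suc (sumDepth S ss)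

  Φ : Obj S → ℕ
  Φ o = sum (map φ (toSeq S o))

  -- Needed to make the sum of at most ℓ small parts strictly smaller.
  φ-positive : ∀ t → 1 ≤ φ t
  φ-positive (app f ss) = *-mono-≤ (*-mono-≤ (m^n>0 d (rk f)) (m^n>0 (suc ℓ) (rk f))) (s≤s z≤n)

  args-sumDepth : ∀ {f ss g ts} → (∀ j → Sub S (app f ss) (lookup ts j)) →
                  suc (sumDepth S {ar g} ts) ≤ d * suc (sumDepth S ss)
  args-sumDepth {f} {ss} {g} {ts} sub = begin
    1 + sumDepth S ts   ≤⟨ +-mono-≤ d≥1 (≤-trans (sumDepth-≤ ts D (λ j → sub-depth-≤-sumDepth (sub j)))
                                                 (*-monoˡ-≤ D (ar≤d g))) ⟩
    d + d * D           ≡⟨ sym (*-suc d D) ⟩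
    d * suc D           ∎
    where open ≤-Reasoning
          D = sumDepth S ss

  rank-step : ∀ {f ss g ts} → rk g < rk f → (∀ j → Sub S (app f ss) (lookup ts j)) →
              suc ℓ * φ (app g ts) ≤ φ (app f ss)
  rank-step {f} {ss} {g} {ts} rk< sub = begin
    suc ℓ * (weight (rk g) * suc (sumDepth S ts))
      ≤⟨ *-monoʳ-≤ (suc ℓ) (*-monoʳ-≤ (weight (rk g)) (args-sumDepth {f} {ss} {g} {ts} sub)) ⟩
    suc ℓ * (weight (rk g) * (d * suc (sumDepth S ss)))
      ≡⟨ weight-suc (rk g) (suc (sumDepth S ss)) ⟩
    weight (suc (rk g)) * suc (sumDepth S ss)
      ≤⟨ *-monoˡ-≤ (suc (sumDepth S ss)) (weight-mono rk<) ⟩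
    weight (rk f) * suc (sumDepth S ss) ∎
    where open ≤-Reasoning

  term-step : ∀ {a b} → Gt S _≻_ ℓ (tm a) (tm b) → suc ℓ * φ b ≤ φ a
  term-step (gt-fun {f} {ss} {g} {ts} f≻g sub _) = rank-step {f} {ss} {g} {ts} (rk-mono f≻g) sub

  term-decreases : ∀ {a b} → Gt S _≻_ ℓ (tm a) b → Φ b < φ a
  term-decreases {a} {tm b} gt@(gt-fun _ _ _) =
    sum-of-small-parts ℓ (φ a) φ {b ∷ []} (φ-positive a) ℓ≥1 (term-step gt ∷ [])
  term-decreases {a} (gt-seq steps len) =
    sum-of-small-parts ℓ (φ a) φ (φ-positive a) len (All-map term-step steps)

  term-weakly-decreases : ∀ {a b} → Ge S _≻_ ℓ (tm a) b → Φ b ≤ φ a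
  term-weakly-decreases (ge-gt gt) = <⇒≤ (term-decreases gt)
  term-weakly-decreases ge-eq      = ≤-reflexive (+-identityʳ _)

  decreases : ∀ {a b} → Gt S _≻_ ℓ a b → Φ b < Φ a
  decreases {tm a} gt = <-≤-trans (term-decreases gt) (m≤m+n (φ a) 0)
  decreases (gt-mul {ss} {ts} bs perm ges some-gt) = begin-strict
    sum (map φ ts)                            ≡⟨ sym (sum-↭ (map⁺ φ perm)) ⟩
    sum (map φ (concat (map (toSeq S) bs)))   ≡⟨ sum-concat-map φ (toSeq S) bs ⟩
    sum (map Φ bs)                            <⟨ sum-pointwise-< φ Φ term-weakly-decreases
                                                   term-decreases ges some-gt ⟩
    sum (map φ ss)                            ∎
    where open ≤-Reasoning

  chain-bound : ∀ {a n} → Chain S _≻_ ℓ a n → n ≤ Φ a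
  chain-bound done           = z≤n
  chain-bound (step gt rest) = <-≤-trans (s≤s (chain-bound rest)) (decreases gt)

lemma3 : (S : Signature) → let open Signature S in
    (_≻_ : Sym → Sym → Set) → (rk : Sym → ℕ) →
    IsStrictPartialOrder _≡_ _≻_ →
    WellFounded (λ g f → f ≻ g) →
    (∀ c g → Con c → ¬ (c ≻ g)) →
    (∀ f g → (rk f > rk g → f ≻ g) × (f ≻ g → rk f > rk g)) →
    (ℓ : ℕ) → 1 ≤ ℓ →
    (d : ℕ) → 1 ≤ d → (∀ f → ar f ≤ d) →
    (f : Sym) → ar f ≤ ℓ →
    (ss : Vec (Term S) (ar f)) → (∀ i → IsConTerm S (lookup ss i)) →
    (n : ℕ) → Chain S _≻_ ℓ (tm (app f ss)) n →
    n ≤ d ^ rk f * (1 + ℓ) ^ rk f * (1 + sumDepth S ss)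
lemma3 S _≻_ rk _ _ _ rk-iff ℓ ℓ≥1 d d≥1 ar≤d f _ ss _ n chain =
  ≤-trans (chain-bound chain) (≤-reflexive (+-identityʳ _))
  where open Interpretation S _≻_ rk (λ {f} {g} → proj₂ (rk-iff f g)) ℓ ℓ≥1 d d≥1 ar≤d
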